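{- Let $C$ be a dendritic face complex with greatest element $\omega$, $n=\dim\omega$. Then for every $0\le k\le n$, $$C_k\setminus\{\gamma^{(k)}\omega\}=\coprod_{c\in\Lambda_{k+1}}\delta(c),$$ i.e. $C_k\setminus\{\gamma^{(k)}\omega\}$ is the union of the sets $\delta(c)$, $c\in\Lambda_{k+1}$, and these sets are pairwise disjoint.
   Context: A positive-to-one poset (POP) is a finite set $P$ with $\dim:P\to\mathbb{N}$ and binary relations $\prec^-,\prec^+$; $y\prec x$ means $y\prec^-x$ or $y\prec^+x$. Axioms: $y\prec x\Rightarrow\dim x=\dim y+1$; never both $y\prec^-x$ and $y\prec^+x$; every $x$ with $\dim x\ge1$ has exactly one $y$ with $y\prec^+x$, denoted $\gamma(x)$, and at least one $y$ with $y\prec^-x$. $\delta(x)=\{y:y\prec^-x\}$, $P_k=\dim^{ -1}(k)$; $\le$ is the reflexive-transitive closure of $\prec$. A dendritic face complex is a POP such that: $(P,\le)$ has a greatest element; (oriented thinness) whenever $z\prec^{\beta}y\prec^{\alpha}x$ there is a unique $y'\ne y$ with $z\prec y'\prec x$, and writing $z\prec^{\beta'}y'\prec^{\alpha'}x$ the signs (as $\pm1$) satisfy $\alpha\beta=-\alpha'\beta'$; (acyclicity) $\delta(x)$ is a singleton if $\dim x=1$, nonempty if $\dim x\ge1$, and for $\dim x\ge1$ there are no $p\ge1$, $y_1,\dots,y_p\in\delta(x)$ with $\gamma(y_{i+1})\in\delta(y_i)$ ($1\le i<p$) and $\gamma(y_1)\in\delta(y_p)$. For $0\le k\le n$, $\gamma^{(k)}\omega:=\gamma^{n-k}(\omega)$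 (the iterated target of $\omega$ of dimension $k$). $\Lambda_k:=C_k\setminus\{\gamma(c):c\in C_{k+1}\}$ (so $\Lambda_{n+1}=\emptyset$). -}

module Defs where

open import Data.Nat using (ℕ; zero; suc; _+_; _≤_; _∸_)
open import Data.Fin using (Fin)
open import Data.Product using (Σ; ∃; ∃-syntax; _×_; _,_; proj₁)
open import Data.Vec using (Vec; lookup)
open import Data.Fin using (toℕ)
open import Relation.Nullary using (¬_)
open import Relation.Binary.PropositionalEquality using (_≡_; _≢_)
open import Relation.Binary.Construct.Closure.ReflexiveTransitive using (Star)
open import Level using (0ℓ)
open import Data.Empty using (⊥)

data Sign : Set where
  minus plus : Sign

_·_ : Sign → Sign → Sign
minus · minus = plus
minus · plus  = minus
plus  · minus = minus
plus  · plus  = plus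

neg : Sign → Sign
neg minus = plus
neg plus  = minus

-- A positive-to-one poset on the finite carrier Fin N.
-- rel s y x  means  y ≺^s x.
record POP : Set₁ where
  field
    N    : ℕ
    dim  : Fin N → ℕ
    rel  : Sign → Fin N → Fin N → Set
    rel-dim  : ∀ s y x → rel s y x → dim x ≡ suc (dim y)
    rel-excl : ∀ y x → rel minus y x → rel plus y x → ⊥
    plus-exists : ∀ x → 1 ≤ dim x → ∃[ y ] rel plus y x
    plus-unique : ∀ x y y' → rel plus y x → rel plus y' x → y ≡ y'
    minus-exists : ∀ x → 1 ≤ dim x → ∃[ y ] rel minus y x

module _ (P : POP) where
  open POP P

  _≺_ : Fin N → Fin N → Set
  y ≺ x = Σ Sign λ s → rel s y x

  _≤P_ : Fin N → Fin N → Set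
  _≤P_ = Star _≺_

  Inδ : Fin N → Fin N → Set
  Inδ y x = rel minus y x

  -- γ(x) ≡ y, i.e. y ≺⁺ x (the unique such y)
  IsTarget : Fin N → Fin N → Set
  IsTarget y x = rel plus y x

  -- t is an iterate γ^m(x) for some m ≥ 0: a ≺⁺-chain from x down to t
  -- (Star of the relation "a is the target of b", read as b ⟶ a)
  IterTarget : Fin N → Fin N → Set
  IterTarget t x = Star (λ b a → rel plus a b) x t

  InΛ : ℕ → Fin N → Set
  InΛ k c = (dim c ≡ k) × ¬ (Σ (Fin N) λ d → (dim d ≡ suc k) × IsTarget c d)

record DendriticFaceComplex : Set₁ where
  field
    pop : POP
  open POP pop public
  field
    ω : Fin N
    greatest : ∀ x → _≤P_ pop x ω
    thin-exists : ∀ α β z y x → rel β z y → rel α y x →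
      Σ (Fin N) λ y' → (y' ≢ y) × Σ Sign λ β' → Σ Sign λ α' →
        rel β' z y' × rel α' y' x × (α · β ≡ neg (α' · β'))
    thin-unique : ∀ α β z y x → rel β z y → rel α y x →
      ∀ y₁ y₂ → y₁ ≢ y → y₂ ≢ y →
      _≺_ pop z y₁ → _≺_ pop y₁ x → _≺_ pop z y₂ → _≺_ pop y₂ x → y₁ ≡ y₂
    δ-single : ∀ x → dim x ≡ 1 → ∀ y y' → Inδ pop y x → Inδ pop y' x → y ≡ y'
    δ-nonempty : ∀ x → 1 ≤ dim x → ∃[ y ] Inδ pop y x
    acyclic : ∀ x → 1 ≤ dim x → (p : ℕ) → (ys : Vec (Fin N) (suc p)) →
      (∀ i → Inδ pop (lookup ys i) x) →
      (∀ (i : Fin p) → Σ (Fin N) λ g →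
         IsTarget pop g (lookup ys (Data.Fin.suc i)) ×
         Inδ pop g (lookup ys (Data.Fin.inject₁ i))) →
      ¬ (Σ (Fin N) λ g → IsTarget pop g (lookup ys Data.Fin.zero) ×
           Inδ pop g (lookup ys (Data.Fin.fromℕ p)))

{-# OPTIONS --safe #-}
-- Write δx for the input faces and γx for the target of x, and let X be the iterated target of
-- ω of dimension k + 2 (the cases k = n and k = n - 1 are direct). Oriented thinness alone shows
-- that the codimension-2 faces of X other than γγX are exactly the members of the sets δc, c ∈ δX,
-- and that these sets are pairwise disjoint; everything of dimension k is such a face. So the
-- theorem amounts to Λ_{k+1} = δX.
--
-- Both inclusions come from a flow inside an element x. By thinness, an input face of an input
-- face y of x is either an input face of γx or the target of another input face y′ of x, and
-- acyclicity makes the passage from y to y′ well-founded on the finite set δx. Hence a property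
-- holding on δγx and passing from all of δy′ to γy′ holds on all of δδx. This gives that the
-- codimension-2 faces of input faces of x are faces of γx, so that everything of dimension j lies
-- under the iterated target of dimension j + 2; and that no target of a member of δδW lies in
-- δγγW, so that no member of δX is a target.

module Submission where

open import Defs hiding (_≺_)
open import Data.Nat using (ℕ; zero; suc; _≤_; _<_; _+_; _∸_; z≤n; s≤s)
open import Data.Nat.Properties
  using (≤-refl; ≤-trans; ≤-reflexive; <⇒≤; <-irrefl; n≤1+n; m≤n+m; suc-injective; m∸n+n≡m; m≤n⇒m<n∨m≡n)
open import Data.Fin using (Fin; inject₁; fromℕ) renaming (zero to fzero; suc to fsuc)
open import Data.Fin.Properties using (_≟_)
open import Data.Fin.Induction using (spo-noetherian)
open import Data.Vec using (Vec; []; _∷_; lookup)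
open import Data.Product using (Σ; Σ-syntax; _×_; _,_; proj₁; proj₂)
open import Data.Sum using (_⊎_; inj₁; inj₂)
open import Data.Empty using (⊥; ⊥-elim)
open import Function using (flip; _∘_)
open import Function.Bundles using (_⇔_; mk⇔)
open import Induction.WellFounded using (WellFounded; Acc; acc; module Subrelation)
open import Relation.Nullary using (¬_; yes; no)
open import Relation.Binary.PropositionalEquality
  using (_≡_; refl; sym; trans; cong; subst; subst₂; isEquivalence; resp₂)
open import Relation.Binary.Structures using (IsStrictPartialOrder)
open import Relation.Binary.Construct.Closure.ReflexiveTransitive using (Star; ε; _◅_; _◅◅_; reverse)
open import Relation.Binary.Construct.Closure.Transitive using (TransClosure; [_]; _∷_; _++_)

module FaceOrder (P : POP) where
  open POP P

  infix 4 _≺⁻_ _≺⁺_ _≺_ _≼_ _≺²_ _≺⁺*_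

  _≺⁻_ _≺⁺_ _≺_ _≼_ _≺⁺*_ _≺²_ : Fin N → Fin N → Set
  _≺⁻_ = rel minus
  _≺⁺_ = rel plus
  _≺_ = Defs._≺_ P
  _≼_ = _≤P_ P
  _≺⁺*_ = Star _≺⁺_
  z ≺² x = Σ[ y ∈ Fin N ] z ≺ y × y ≺ x

  ≺-dim : ∀ {y x} → y ≺ x → dim x ≡ suc (dim y)
  ≺-dim (s , y≺x) = rel-dim s _ _ y≺x

  ≺⁻-dim : ∀ {y x} → y ≺⁻ x → dim x ≡ suc (dim y)
  ≺⁻-dim = rel-dim minus _ _

  ≺⁺-dim : ∀ {y x} → y ≺⁺ x → dim x ≡ suc (dim y)
  ≺⁺-dim = rel-dim plus _ _

  ≺-pos : ∀ {y x} → y ≺ x → 1 ≤ dim x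
  ≺-pos y≺x = subst (1 ≤_) (sym (≺-dim y≺x)) (s≤s z≤n)

  γ-unique : ∀ {a b x} → a ≺⁺ x → b ≺⁺ x → a ≡ b
  γ-unique = plus-unique _ _ _

  δ-γ-excl : ∀ {a x} → a ≺⁻ x → ¬ a ≺⁺ x
  δ-γ-excl = rel-excl _ _

  module _ {R : Fin N → Fin N → Set} (R-dim : ∀ {a b} → R a b → dim b ≡ suc (dim a)) where

    star-dim-≤ : ∀ {a b} → Star R a b → dim a ≤ dim b
    star-dim-< : ∀ {a c b} → R a c → Star R c b → dim a < dim b
    star-dim-≤ ε = ≤-refl
    star-dim-≤ (r ◅ rs) = <⇒≤ (star-dim-< r rs)
    star-dim-< {b = b} r rs = subst (_≤ dim b) (R-dim r) (star-dim-≤ rs)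

  ≼-dim : ∀ {z x} → z ≼ x → dim z ≤ dim x
  ≼-dim = star-dim-≤ ≺-dim

  ≺⁺*-dim : ∀ {t x} → t ≺⁺* x → dim t ≤ dim x
  ≺⁺*-dim = star-dim-≤ ≺⁺-dim

  ≼-dim-≡ : ∀ {z x} → z ≼ x → dim z ≡ dim x → z ≡ x
  ≼-dim-≡ ε _ = refl
  ≼-dim-≡ (r ◅ rs) eq = ⊥-elim (<-irrefl eq (star-dim-< ≺-dim r rs))

  ≼-uncons : ∀ {z x} → z ≼ x → dim z < dim x → Σ[ c ∈ Fin N ] z ≺ c × c ≼ x
  ≼-uncons ε lt = ⊥-elim (<-irrefl refl lt)
  ≼-uncons (r ◅ rs) _ = _ , r , rs

  ≼-codim1 : ∀ {z x} → z ≼ x → dim x ≡ suc (dim z) → z ≺ x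
  ≼-codim1 {z} z≼x eq with ≼-uncons z≼x (≤-reflexive (sym eq))
  ... | c , z≺c , c≼x = subst (z ≺_) (≼-dim-≡ c≼x (trans (≺-dim z≺c) (sym eq))) z≺c

  ≼-codim2 : ∀ {z x} → z ≼ x → dim x ≡ 2 + dim z → z ≺² x
  ≼-codim2 z≼x eq with ≼-uncons z≼x (≤-trans (n≤1+n _) (≤-reflexive (sym eq)))
  ... | c , z≺c , c≼x = c , z≺c , ≼-codim1 c≼x (trans eq (cong suc (sym (≺-dim z≺c))))

  -- t ≺⁺* x is IterTarget P t x read upwards, so that a chain can be taken apart at its bottom.
  ≺⁺*⇒iterTarget : ∀ {t x} → t ≺⁺* x → IterTarget P t x
  ≺⁺*⇒iterTarget = reverse (λ r → r)

  iterTarget⇒≺⁺* : ∀ {t x} → IterTarget P t x → t ≺⁺* x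
  iterTarget⇒≺⁺* = reverse (λ r → r)

  ≺⁺*-exists : ∀ x {j} → j ≤ dim x → Σ[ t ∈ Fin N ] t ≺⁺* x × dim t ≡ j
  ≺⁺*-exists x {j} j≤dim-x = go (dim x ∸ j) x (sym (m∸n+n≡m j≤dim-x))
    where
      go : ∀ d x → dim x ≡ d + j → Σ[ t ∈ Fin N ] t ≺⁺* x × dim t ≡ j
      go zero x eq = x , ε , eq
      go (suc d) x eq with plus-exists x (subst (1 ≤_) (sym eq) (s≤s z≤n))
      ... | g , g≺⁺x with go d g (suc-injective (trans (sym (≺⁺-dim g≺⁺x)) eq))
      ...   | t , t≺⁺*g , dim-t = t , t≺⁺*g ◅◅ (g≺⁺x ◅ ε) , dim-t

  iterTarget-dim-< : ∀ {t a x} → a ≺⁺ x → IterTarget P t a → dim t < dim x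
  iterTarget-dim-< {t} a≺⁺x t-a =
    subst (dim t <_) (sym (≺⁺-dim a≺⁺x)) (s≤s (≺⁺*-dim (iterTarget⇒≺⁺* t-a)))

  iterTarget-unique : ∀ {t t′ x} → IterTarget P t x → IterTarget P t′ x → dim t ≡ dim t′ → t ≡ t′
  iterTarget-unique ε ε _ = refl
  iterTarget-unique ε (r ◅ rs) eq = ⊥-elim (<-irrefl (sym eq) (iterTarget-dim-< r rs))
  iterTarget-unique (r ◅ rs) ε eq = ⊥-elim (<-irrefl eq (iterTarget-dim-< r rs))
  iterTarget-unique (r ◅ rs) (r′ ◅ rs′) eq with γ-unique r r′
  ... | refl = iterTarget-unique rs rs′ eq

  iterTarget-γ : ∀ {z G x} → IterTarget P z x → G ≺⁺* x → dim G ≡ suc (dim z) → z ≺⁺ G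
  iterTarget-γ {z} {G} z-x G≺⁺*x eq with plus-exists G (subst (1 ≤_) (sym eq) (s≤s z≤n))
  ... | t , t≺⁺G = subst (_≺⁺ G) (sym z≡t) t≺⁺G
    where
      z≡t : z ≡ t
      z≡t = iterTarget-unique z-x (≺⁺*⇒iterTarget (t≺⁺G ◅ G≺⁺*x))
              (suc-injective (trans (sym eq) (≺⁺-dim t≺⁺G)))

  NonTarget : Fin N → Set
  NonTarget c = ∀ {d} → ¬ c ≺⁺ d

  Λ⇒nonTarget : ∀ {k c} → InΛ P (suc k) c → NonTarget c
  Λ⇒nonTarget (dim-c , no-d) c≺⁺d = no-d (_ , trans (≺⁺-dim c≺⁺d) (cong suc dim-c) , c≺⁺d)

  nonTarget⇒Λ : ∀ {k c} → dim c ≡ suc k → NonTarget c → InΛ P (suc k) c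
  nonTarget⇒Λ dim-c nt = dim-c , λ { (_ , _ , c≺⁺d) → nt c≺⁺d }

  Λ-δ-dim : ∀ {k c z} → InΛ P (suc k) c → z ≺⁻ c → dim z ≡ k
  Λ-δ-dim (dim-c , _) z≺⁻c = suc-injective (trans (sym (≺⁻-dim z≺⁻c)) dim-c)

module Complex (C : DendriticFaceComplex) where
  open DendriticFaceComplex C
  open FaceOrder pop

  γδ∉δγ : ∀ {X V d c} → X ≺⁺ V → d ≺⁻ V → c ≺⁺ d → ¬ c ≺⁻ X
  γδ∉δγ {X} {V} {d} {c} X≺⁺V d≺⁻V c≺⁺d c≺⁻X with thin-exists minus plus c d V c≺⁺d d≺⁻V
  ... | y , y≢d , minus , minus , c≺⁻y , y≺⁻V , _ = δ-γ-excl y≺⁻V (subst (_≺⁺ V) X≡y X≺⁺V)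
    where
      X≡y : X ≡ y
      X≡y = thin-unique minus plus c d V c≺⁺d d≺⁻V X y (λ { refl → δ-γ-excl d≺⁻V X≺⁺V }) y≢d
              (minus , c≺⁻X) (plus , X≺⁺V) (minus , c≺⁻y) (minus , y≺⁻V)
  ... | y , _ , plus , plus , c≺⁺y , y≺⁺V , _ = δ-γ-excl c≺⁻X (subst (c ≺⁺_) (γ-unique y≺⁺V X≺⁺V) c≺⁺y)

  γγ∉δδ : ∀ {X G t c} → G ≺⁺ X → t ≺⁺ G → c ≺⁻ X → ¬ t ≺⁻ c
  γγ∉δδ {X} {G} {t} {c} G≺⁺X t≺⁺G c≺⁻X t≺⁻c with thin-exists plus plus t G X t≺⁺G G≺⁺X
  ... | y , y≢G , plus , minus , t≺⁺y , y≺⁻X , _ = δ-γ-excl t≺⁻c (subst (t ≺⁺_) (sym c≡y) t≺⁺y)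
    where
      c≡y : c ≡ y
      c≡y = thin-unique plus plus t G X t≺⁺G G≺⁺X c y (λ { refl → δ-γ-excl c≺⁻X G≺⁺X }) y≢G
              (minus , t≺⁻c) (minus , c≺⁻X) (plus , t≺⁺y) (minus , y≺⁻X)
  ... | y , y≢G , minus , plus , _ , y≺⁺X , _ = y≢G (γ-unique y≺⁺X G≺⁺X)

  δδ-unique : ∀ {X z c c′} → c ≺⁻ X → c′ ≺⁻ X → z ≺⁻ c → z ≺⁻ c′ → c ≡ c′
  δδ-unique {X} {z} {c} {c′} c≺⁻X c′≺⁻X z≺⁻c z≺⁻c′ with c ≟ c′
  ... | yes c≡c′ = c≡c′
  ... | no c≢c′ with thin-exists minus minus z c X z≺⁻c c≺⁻X
  ...   | y , y≢c , β , α , z≺y , y≺X , sign = ⊥-elim (no-second-path β α z≺y y≺X sign)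
    where
      c′≡y : c′ ≡ y
      c′≡y = thin-unique minus minus z c X z≺⁻c c≺⁻X c′ y (c≢c′ ∘ sym) y≢c
               (minus , z≺⁻c′) (minus , c′≺⁻X) (β , z≺y) (α , y≺X)
      no-second-path : ∀ β α → rel β z y → rel α y X → plus ≡ neg (α · β) → ⊥
      no-second-path plus minus z≺⁺y _ _ = δ-γ-excl z≺⁻c′ (subst (z ≺⁺_) (sym c′≡y) z≺⁺y)
      no-second-path minus plus _ y≺⁺X _ = δ-γ-excl c′≺⁻X (subst (_≺⁺ X) (sym c′≡y) y≺⁺X)

  ≺²⇒γγ⊎δδ : ∀ {X G z} → G ≺⁺ X → z ≺² X → z ≺⁺ G ⊎ Σ[ c ∈ Fin N ] c ≺⁻ X × z ≺⁻ c
  ≺²⇒γγ⊎δδ G≺⁺X (y , (minus , z≺⁻y) , (minus , y≺⁻X)) = inj₂ (y , y≺⁻X , z≺⁻y)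
  ≺²⇒γγ⊎δδ {z = z} G≺⁺X (y , (plus , z≺⁺y) , (plus , y≺⁺X)) =
    inj₁ (subst (z ≺⁺_) (γ-unique y≺⁺X G≺⁺X) z≺⁺y)
  ≺²⇒γγ⊎δδ {X} {z = z} G≺⁺X (y , (plus , z≺⁺y) , (minus , y≺⁻X)) with thin-exists minus plus z y X z≺⁺y y≺⁻X
  ... | y′ , _ , minus , minus , z≺⁻y′ , y′≺⁻X , _ = inj₂ (y′ , y′≺⁻X , z≺⁻y′)
  ... | y′ , _ , plus , plus , z≺⁺y′ , y′≺⁺X , _ = inj₁ (subst (z ≺⁺_) (γ-unique y′≺⁺X G≺⁺X) z≺⁺y′)
  ≺²⇒γγ⊎δδ {X} {z = z} G≺⁺X (y , (minus , z≺⁻y) , (plus , y≺⁺X)) with thin-exists plus minus z y X z≺⁻y y≺⁺X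
  ... | y′ , _ , minus , minus , z≺⁻y′ , y′≺⁻X , _ = inj₂ (y′ , y′≺⁻X , z≺⁻y′)
  ... | y′ , y′≢y , plus , plus , _ , y′≺⁺X , _ = ⊥-elim (y′≢y (γ-unique y′≺⁺X y≺⁺X))

  ≺²⇒≺δ : ∀ {z y} → z ≺² y → Σ[ e ∈ Fin N ] z ≺ e × e ≺⁻ y
  ≺²⇒≺δ (e , z≺e , (minus , e≺⁻y)) = e , z≺e , e≺⁻y
  ≺²⇒≺δ {z} {y} (e , (β , z≺e) , (plus , e≺⁺y)) with thin-exists plus β z e y z≺e e≺⁺y
  ... | e′ , _ , β′ , minus , z≺e′ , e′≺⁻y , _ = e′ , (β′ , z≺e′) , e′≺⁻y
  ... | e′ , e′≢e , _ , plus , _ , e′≺⁺y , _ = ⊥-elim (e′≢e (γ-unique e′≺⁺y e≺⁺y))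

  γγ∈γδ : ∀ {c d y} → c ≺⁺ d → d ≺⁺ y → Σ[ y′ ∈ Fin N ] y′ ≺⁻ y × c ≺⁺ y′
  γγ∈γδ {c} {d} {y} c≺⁺d d≺⁺y with thin-exists plus plus c d y c≺⁺d d≺⁺y
  ... | y′ , _ , plus , minus , c≺⁺y′ , y′≺⁻y , _ = y′ , y′≺⁻y , c≺⁺y′
  ... | y′ , y′≢d , minus , plus , _ , y′≺⁺y , _ = ⊥-elim (y′≢d (γ-unique y′≺⁺y d≺⁺y))

  δδ⊆δγ∪γδ : ∀ {x g y e} → g ≺⁺ x → y ≺⁻ x → e ≺⁻ y → e ≺⁻ g ⊎ Σ[ y′ ∈ Fin N ] y′ ≺⁻ x × e ≺⁺ y′
  δδ⊆δγ∪γδ {x} {g} {y} {e} g≺⁺x y≺⁻x e≺⁻y with thin-exists minus minus e y x e≺⁻y y≺⁻x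
  ... | y′ , _ , plus , minus , e≺⁺y′ , y′≺⁻x , _ = inj₂ (y′ , y′≺⁻x , e≺⁺y′)
  ... | y′ , _ , minus , plus , e≺⁻y′ , y′≺⁺x , _ = inj₁ (subst (e ≺⁻_) (γ-unique y′≺⁺x g≺⁺x) e≺⁻y′)

  ≺²∖γ⇒δγ : ∀ {X W c} → X ≺⁺ W → c ≺² W → NonTarget c → c ≺⁻ X
  ≺²∖γ⇒δγ X≺⁺W (y , (plus , c≺⁺y) , _) nt = ⊥-elim (nt c≺⁺y)
  ≺²∖γ⇒δγ {c = c} X≺⁺W (y , (minus , c≺⁻y) , (plus , y≺⁺W)) _ = subst (c ≺⁻_) (γ-unique y≺⁺W X≺⁺W) c≺⁻y
  ≺²∖γ⇒δγ X≺⁺W (y , (minus , c≺⁻y) , (minus , y≺⁻W)) nt with δδ⊆δγ∪γδ X≺⁺W y≺⁻W c≺⁻y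
  ... | inj₁ c≺⁻X = c≺⁻X
  ... | inj₂ (_ , _ , c≺⁺y′) = ⊥-elim (nt c≺⁺y′)

  γ∂∉δγ : ∀ {X V d c} → X ≺⁺ V → d ≺ V → c ≺⁺ d → ¬ c ≺⁻ X
  γ∂∉δγ {c = c} X≺⁺V (plus , d≺⁺V) c≺⁺d c≺⁻X = δ-γ-excl c≺⁻X (subst (c ≺⁺_) (γ-unique d≺⁺V X≺⁺V) c≺⁺d)
  γ∂∉δγ X≺⁺V (minus , d≺⁻V) = γδ∉δγ X≺⁺V d≺⁻V

  module Inputs (x : Fin N) where

    Feeds : Fin N → Fin N → Set
    Feeds a b = a ≺⁻ x × Σ[ g ∈ Fin N ] g ≺⁺ a × g ≺⁻ b

    record Walk (a b : Fin N) : Set where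
      constructor walk
      field
        {length} : ℕ
        inner : Vec (Fin N) length
        links : ∀ i → Feeds (lookup (a ∷ inner) (fsuc i)) (lookup (a ∷ inner) (inject₁ i))
        last : Feeds b (lookup (a ∷ inner) (fromℕ length))

    -- The acyclicity axiom lists a cycle against the direction of Feeds.
    fedBy⁺⇒walk : ∀ {a b} → TransClosure (flip Feeds) a b → Walk a b
    fedBy⁺⇒walk [ b-feeds-a ] = walk [] (λ ()) b-feeds-a
    fedBy⁺⇒walk (y-feeds-a ∷ path) with fedBy⁺⇒walk path
    ... | walk inner links last =
      walk (_ ∷ inner) (λ { fzero → y-feeds-a ; (fsuc i) → links i }) last

    closed-walk-impossible : ∀ {a} → Walk a a → ⊥
    closed-walk-impossible {a} (walk {p} inner links last) =
      acyclic x (≺-pos (minus , proj₁ last)) p (a ∷ inner) input (proj₂ ∘ links) (proj₂ last)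
      where
        input : ∀ i → lookup (a ∷ inner) i ≺⁻ x
        input fzero = proj₁ last
        input (fsuc i) = proj₁ (links i)

    fedBy⁺-isStrictPartialOrder : IsStrictPartialOrder _≡_ (TransClosure (flip Feeds))
    fedBy⁺-isStrictPartialOrder = record
      { isEquivalence = isEquivalence
      ; irrefl = λ { refl → closed-walk-impossible ∘ fedBy⁺⇒walk }
      ; trans = _++_
      ; <-resp-≈ = resp₂ _
      }

    feeds-wellFounded : WellFounded Feeds
    feeds-wellFounded = Subrelation.wellFounded [_] (spo-noetherian fedBy⁺-isStrictPartialOrder)

    input-induction : ∀ {g} → g ≺⁺ x → (Q : Fin N → Set) →
      (∀ {e} → e ≺⁻ g → Q e) →
      (∀ {y e} → e ≺⁺ y → (∀ {e′} → e′ ≺⁻ y → Q e′) → Q e) →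
      ∀ {y e} → y ≺⁻ x → e ≺⁻ y → Q e
    input-induction {g} g≺⁺x Q base step {y} y≺⁻x = go (feeds-wellFounded y) y≺⁻x
      where
        go : ∀ {y} → Acc Feeds y → y ≺⁻ x → ∀ {e} → e ≺⁻ y → Q e
        go (acc rs) y≺⁻x e≺⁻y with δδ⊆δγ∪γδ g≺⁺x y≺⁻x e≺⁻y
        ... | inj₁ e≺⁻g = base e≺⁻g
        ... | inj₂ (y′ , y′≺⁻x , e≺⁺y′) = step e≺⁺y′ (go (rs (y′≺⁻x , _ , e≺⁺y′ , e≺⁻y)) y′≺⁻x)

  open Inputs using (input-induction)

  ≺²δ⇒≺²γ : ∀ {x g y z} → g ≺⁺ x → y ≺⁻ x → z ≺² y → z ≺² g
  ≺²δ⇒≺²γ {x} {g} g≺⁺x y≺⁻x z≺²y with ≺²⇒≺δ z≺²y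
  ... | e , z≺e , e≺⁻y = input-induction x g≺⁺x Q base step y≺⁻x e≺⁻y z≺e
    where
      Q : Fin N → Set
      Q e = ∀ {z} → z ≺ e → z ≺² g
      base : ∀ {e} → e ≺⁻ g → Q e
      base e≺⁻g z≺e = _ , z≺e , (minus , e≺⁻g)
      step : ∀ {y e} → e ≺⁺ y → (∀ {e′} → e′ ≺⁻ y → Q e′) → Q e
      step e≺⁺y ih z≺e with ≺²⇒≺δ (_ , z≺e , (plus , e≺⁺y))
      ... | e′ , z≺e′ , e′≺⁻y = ih e′≺⁻y z≺e′

  γδδ∉δγγ : ∀ {W V X y d} → V ≺⁺ W → X ≺⁺ V → y ≺⁻ W → d ≺⁻ y → ∀ {c} → c ≺⁺ d → ¬ c ≺⁻ X
  γδδ∉δγγ {W} {V} {X} V≺⁺W X≺⁺V = input-induction W V≺⁺W Q (λ d≺⁻V → γδ∉δγ X≺⁺V d≺⁻V) step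
    where
      Q : Fin N → Set
      Q d = ∀ {c} → c ≺⁺ d → ¬ c ≺⁻ X
      step : ∀ {y d} → d ≺⁺ y → (∀ {d′} → d′ ≺⁻ y → Q d′) → Q d
      step d≺⁺y ih c≺⁺d with γγ∈γδ c≺⁺d d≺⁺y
      ... | y′ , y′≺⁻y , c≺⁺y′ = ih y′≺⁻y c≺⁺y′

  γ∂²∉δγγ : ∀ {W V X d c} → V ≺⁺ W → X ≺⁺ V → d ≺² W → c ≺⁺ d → ¬ c ≺⁻ X
  γ∂²∉δγγ V≺⁺W X≺⁺V d≺²W with ≺²⇒γγ⊎δδ V≺⁺W d≺²W
  ... | inj₁ d≺⁺V = γ∂∉δγ X≺⁺V (plus , d≺⁺V)
  ... | inj₂ (y , y≺⁻W , d≺⁻y) = γδδ∉δγγ V≺⁺W X≺⁺V y≺⁻W d≺⁻y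

  ≺⁺*⇒≺² : ∀ {z x t} → z ≼ x → t ≺⁺* x → dim t ≡ 2 + dim z → z ≺² t
  ≺⁺*⇒≺² z≼x ε eq = ≼-codim2 z≼x eq
  ≺⁺*⇒≺² {z} {x} {t} z≼x (_◅_ {j = t₁} t≺⁺t₁ t₁≺⁺*x) eq =
    through (≼-uncons z≼x (≤-trans (m≤n+m _ 2) 3+z≤x))
    where
      dim-t₁ : dim t₁ ≡ 3 + dim z
      dim-t₁ = trans (≺⁺-dim t≺⁺t₁) (cong suc eq)
      3+z≤x : 3 + dim z ≤ dim x
      3+z≤x = subst (_≤ dim x) dim-t₁ (≺⁺*-dim t₁≺⁺*x)
      through : Σ[ c ∈ Fin N ] z ≺ c × c ≼ x → z ≺² t
      through (c , z≺c , c≼x) with ≺⁺*⇒≺² c≼x t₁≺⁺*x (trans dim-t₁ (cong (2 +_) (sym (≺-dim z≺c))))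
      ... | y , c≺y , (plus , y≺⁺t₁) = c , z≺c , subst (c ≺_) (γ-unique y≺⁺t₁ t≺⁺t₁) c≺y
      ... | y , c≺y , (minus , y≺⁻t₁) = ≺²δ⇒≺²γ t≺⁺t₁ y≺⁻t₁ (c , z≺c , c≺y)

  ω-nonTarget : NonTarget ω
  ω-nonTarget ω≺⁺d = <-irrefl refl (subst (_≤ dim ω) (≺⁺-dim ω≺⁺d) (≼-dim (greatest _)))

  iterTarget-δ-nonTarget : ∀ {X c} → X ≺⁺* ω → c ≺⁻ X → NonTarget c
  iterTarget-δ-nonTarget {X} {c} X≺⁺*ω c≺⁻X {d} c≺⁺d = go X≺⁺*ω c≺⁻X
    where
      dim-d : dim d ≡ dim X
      dim-d = trans (≺⁺-dim c≺⁺d) (sym (≺⁻-dim c≺⁻X))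
      go : X ≺⁺* ω → c ≺⁻ X → ⊥
      go ε c≺⁻ω = δ-γ-excl c≺⁻ω (subst (c ≺⁺_) (≼-dim-≡ (greatest d) dim-d) c≺⁺d)
      go (X≺⁺V ◅ ε) c≺⁻X =
        γ∂∉δγ X≺⁺V (≼-codim1 (greatest d) (trans (≺⁺-dim X≺⁺V) (cong suc (sym dim-d)))) c≺⁺d c≺⁻X
      go (X≺⁺V ◅ V≺⁺W ◅ W≺⁺*ω) c≺⁻X =
        γ∂²∉δγγ V≺⁺W X≺⁺V (≺⁺*⇒≺² (greatest d) W≺⁺*ω
          (trans (≺⁺-dim V≺⁺W) (cong suc (trans (≺⁺-dim X≺⁺V) (cong suc (sym dim-d)))))) c≺⁺d c≺⁻X

  nonTarget⇒iterTarget-δ : ∀ {X c} → X ≺⁺* ω → dim X ≡ suc (dim c) → NonTarget c → c ≺⁻ X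
  nonTarget⇒iterTarget-δ {c = c} ε eq nt with ≼-codim1 (greatest c) eq
  ... | plus , c≺⁺ω = ⊥-elim (nt c≺⁺ω)
  ... | minus , c≺⁻ω = c≺⁻ω
  nonTarget⇒iterTarget-δ {c = c} (X≺⁺V ◅ V≺⁺*ω) eq =
    ≺²∖γ⇒δγ X≺⁺V (≺⁺*⇒≺² (greatest c) V≺⁺*ω (trans (≺⁺-dim X≺⁺V) (cong suc eq)))

  InC∖γ In⋃δΛ : ℕ → Fin N → Set
  InC∖γ k z = (dim z ≡ k) × ¬ IterTarget pop z ω
  In⋃δΛ k z = Σ[ c ∈ Fin N ] InΛ pop (suc k) c × Inδ pop z c

  Partition : ℕ → Set
  Partition k =
    ((z : Fin N) → InC∖γ k z ⇔ In⋃δΛ k z)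
    × ((z c c′ : Fin N) → InΛ pop (suc k) c → InΛ pop (suc k) c′ →
        Inδ pop z c → Inδ pop z c′ → c ≡ c′)

  partition-codim0 : ∀ {k} → dim ω ≡ k → Partition k
  partition-codim0 {k} dim-ω = (λ z → mk⇔ to (λ { (_ , Λc , _) → ⊥-elim (Λ-empty Λc) }))
                          , λ _ _ _ Λc _ _ _ → ⊥-elim (Λ-empty Λc)
    where
      Λ-empty : ∀ {c} → ¬ InΛ pop (suc k) c
      Λ-empty {c} (dim-c , _) = <-irrefl refl (subst₂ _≤_ dim-c dim-ω (≼-dim (greatest c)))
      to : ∀ {z} → InC∖γ k z → In⋃δΛ k z
      to {z} (dim-z , not-iterTarget) with ≼-dim-≡ (greatest z) (trans dim-z (sym dim-ω))
      ... | refl = ⊥-elim (not-iterTarget ε)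

  partition-codim1 : ∀ {k} → dim ω ≡ suc k → Partition k
  partition-codim1 {k} dim-ω =
    (λ z → mk⇔ to from) , λ _ _ _ Λc Λc′ _ _ → trans (Λ≡ω Λc) (sym (Λ≡ω Λc′))
    where
      Λ≡ω : ∀ {c} → InΛ pop (suc k) c → c ≡ ω
      Λ≡ω {c} (dim-c , _) = ≼-dim-≡ (greatest c) (trans dim-c (sym dim-ω))
      to : ∀ {z} → InC∖γ k z → In⋃δΛ k z
      to {z} (dim-z , not-iterTarget) with ≼-codim1 (greatest z) (trans dim-ω (cong suc (sym dim-z)))
      ... | plus , z≺⁺ω = ⊥-elim (not-iterTarget (z≺⁺ω ◅ ε))
      ... | minus , z≺⁻ω = ω , nonTarget⇒Λ dim-ω ω-nonTarget , z≺⁻ω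
      from : ∀ {z} → In⋃δΛ k z → InC∖γ k z
      from (c , Λc , z≺⁻c) with Λ≡ω Λc
      ... | refl = Λ-δ-dim Λc z≺⁻c , λ z-ω → δ-γ-excl z≺⁻c (iterTarget-γ z-ω ε (≺⁻-dim z≺⁻c))

  partition-codim≥2 : ∀ {k} → 2 + k ≤ dim ω → Partition k
  partition-codim≥2 {k} 2+k≤n with ≺⁺*-exists ω 2+k≤n
  ... | X , X≺⁺*ω , dim-X with plus-exists X (subst (1 ≤_) (sym dim-X) (s≤s z≤n))
  ...   | G , G≺⁺X = (λ z → mk⇔ to from) , λ _ _ _ Λc Λc′ → δδ-unique (Λ⇒δX Λc) (Λ⇒δX Λc′)
    where
      Λ⇒δX : ∀ {c} → InΛ pop (suc k) c → c ≺⁻ X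
      Λ⇒δX Λc = nonTarget⇒iterTarget-δ X≺⁺*ω (trans dim-X (cong suc (sym (proj₁ Λc)))) (Λ⇒nonTarget Λc)
      δX⇒Λ : ∀ {c} → c ≺⁻ X → InΛ pop (suc k) c
      δX⇒Λ c≺⁻X =
        nonTarget⇒Λ (suc-injective (trans (sym (≺⁻-dim c≺⁻X)) dim-X)) (iterTarget-δ-nonTarget X≺⁺*ω c≺⁻X)
      to : ∀ {z} → InC∖γ k z → In⋃δΛ k z
      to {z} (dim-z , not-iterTarget)
        with ≺²⇒γγ⊎δδ G≺⁺X (≺⁺*⇒≺² (greatest z) X≺⁺*ω (trans dim-X (cong (2 +_) (sym dim-z))))
      ... | inj₁ z≺⁺G = ⊥-elim (not-iterTarget (≺⁺*⇒iterTarget (z≺⁺G ◅ G≺⁺X ◅ X≺⁺*ω)))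
      ... | inj₂ (c , c≺⁻X , z≺⁻c) = c , δX⇒Λ c≺⁻X , z≺⁻c
      from : ∀ {z} → In⋃δΛ k z → InC∖γ k z
      from {z} (c , Λc , z≺⁻c) =
        Λ-δ-dim Λc z≺⁻c , λ z-ω → γγ∉δδ G≺⁺X (iterTarget-γ z-ω (G≺⁺X ◅ X≺⁺*ω) dim-G) c≺⁻X z≺⁻c
        where
          c≺⁻X : c ≺⁻ X
          c≺⁻X = Λ⇒δX Λc
          dim-G : dim G ≡ suc (dim z)
          dim-G = trans (suc-injective (trans (sym (≺⁺-dim G≺⁺X)) (≺⁻-dim c≺⁻X))) (≺⁻-dim z≺⁻c)

mainTheorem5 : (C : DendriticFaceComplex) → let open DendriticFaceComplex C in
    (k : ℕ) → k ≤ dim ω →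
    ((z : Fin N) →
      ((dim z ≡ k) × ¬ (IterTarget pop z ω)) ⇔
      Σ (Fin N) (λ c → InΛ pop (suc k) c × Inδ pop z c))
    × ((z c c′ : Fin N) → InΛ pop (suc k) c → InΛ pop (suc k) c′ →
        Inδ pop z c → Inδ pop z c′ → c ≡ c′)
mainTheorem5 C k k≤n with m≤n⇒m<n∨m≡n k≤n
... | inj₂ k≡n = Complex.partition-codim0 C (sym k≡n)
... | inj₁ k<n with m≤n⇒m<n∨m≡n k<n
...   | inj₂ 1+k≡n = Complex.partition-codim1 C (sym 1+k≡n)
...   | inj₁ 2+k≤n = Complex.partition-codim≥2 C 2+k≤n
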